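{- Let $\mathcal{C}$ be an adequate set of formulas. Every rule of $\mathsf{GLP_{NS}}$ (the rules $\wedge$, $\vee$, $\Box$, $\Diamond$, $\mathsf{tran}$, $\mathsf{eucl}$), as well as the rule $\Gamma\{\emptyset\}$ / $\Gamma\{\bot\}$, is invertible for $\mathsf{GLP_{NS}}+\mathsf{cut}(\mathcal{C})$: for every instance of the rule, if the conclusion is provable in $\mathsf{GLP_{NS}}+\mathsf{cut}(\mathcal{C})$, then every premise is provable in $\mathsf{GLP_{NS}}+\mathsf{cut}(\mathcal{C})$.
   Context: Formulas are built from atoms $p$, complements $\overline{p}$, $\top,\bot$, $\wedge,\vee$, and $\Box_i,\Diamond_i$ ($i\in\mathbb{N}$); negation $\overline{A}$ is defined via De Morgan laws, $\overline{\overline{p}}=p$, $\overline{\top}=\bot$, $\overline{\bot}=\top$, $\overline{\Box_iA}=\Diamond_i\overline{A}$, $\overline{\Diamond_iA}=\Box_i\overline{A}$. A finite set of formulas is adequate if it is closed under subformulas and under negation. A nested sequent is (inductively) a finite multiset of formulas and of expressions $[\Delta]_i$ with $\Delta$ a nested sequent and $i\in\mathbb{N}$. A unary context $\Gamma\{\ \}$ is a nested sequent with one hole in place of a formula; $\Gamma\{\Upsilon\}$ fills the hole with $\Upsilon$, $\Gamma\{\emptyset\}$ with the empty sequent. $\mathsf{GLP_{NS}}$ has initial sequents $\Gamma\{p,\overline{p}\}$, $\Gamma\{\top\}$ and rules (premises / conclusion): ($\wedge$) $\Gamma\{A\}$, $\Gamma\{B\}$ / $\Gamma\{A\wedge B\}$;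 ($\vee$) $\Gamma\{A,B\}$ / $\Gamma\{A\vee B\}$; ($\Box$) $\Gamma\{[A,\Diamond_i\overline{A}]_i\}$ / $\Gamma\{\Box_iA\}$; ($\Diamond$) $\Gamma\{\Diamond_iA,[A,\Delta]_j\}$ / $\Gamma\{\Diamond_iA,[\Delta]_j\}$ ($i\le j$); ($\mathsf{tran}$) $\Gamma\{\Diamond_iA,[\Diamond_iA,\Delta]_j\}$ / $\Gamma\{\Diamond_iA,[\Delta]_j\}$ ($i\le j$); ($\mathsf{eucl}$) $\Gamma\{\Diamond_iA,[\Diamond_iA,\Delta]_j\}$ / $\Gamma\{[\Diamond_iA,\Delta]_j\}$ ($i<j$). $\mathsf{GLP_{NS}}+\mathsf{cut}(\mathcal{C})$ adds the rule $\Gamma\{A\}$, $\Gamma\{\overline{A}\}$ / $\Gamma\{\emptyset\}$ restricted to $A\in\mathcal{C}$. -}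

module Defs where

open import Data.Nat using (ℕ; _≤_; _<_)
open import Data.List using (List; []; _∷_; _++_)
open import Data.List.Relation.Unary.All using (All)
open import Data.List.Membership.Propositional using (_∈_)

-- Formulas in negation normal form; atoms are indexed by ℕ.
data Fm : Set where
  at   : ℕ → Fm
  nat  : ℕ → Fm
  ⊤′ ⊥′ : Fm
  _∧′_ _∨′_ : Fm → Fm → Fm
  □ ◇  : ℕ → Fm → Fm

neg : Fm → Fm
neg (at p)    = nat p
neg (nat p)   = at p
neg ⊤′        = ⊥′
neg ⊥′        = ⊤′
neg (A ∧′ B)  = neg A ∨′ neg B
neg (A ∨′ B)  = neg A ∧′ neg B
neg (□ i A)   = ◇ i (neg A)
neg (◇ i A)   = □ i (neg A)

data ImmSub : Fm → Fm → Set where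
  ∧l : ∀ {A B} → ImmSub A (A ∧′ B)
  ∧r : ∀ {A B} → ImmSub B (A ∧′ B)
  ∨l : ∀ {A B} → ImmSub A (A ∨′ B)
  ∨r : ∀ {A B} → ImmSub B (A ∨′ B)
  □s : ∀ {i A} → ImmSub A (□ i A)
  ◇s : ∀ {i A} → ImmSub A (◇ i A)

record Adequate (𝒞 : List Fm) : Set where
  field
    sub-closed : ∀ {A B} → A ∈ 𝒞 → ImmSub B A → B ∈ 𝒞
    neg-closed : ∀ {A} → A ∈ 𝒞 → neg A ∈ 𝒞

-- Nested sequents: lists of items, read as multisets (see _≈_ below).
data Item : Set where
  fm : Fm → Item
  br : ℕ → List Item → Item

Seq : Set
Seq = List Item

mutual
  data _≈_ : Seq → Seq → Set where
    []≈   : [] ≈ []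
    cons≈ : ∀ {x y xs ys} → x ≈ᵢ y → xs ≈ ys → (x ∷ xs) ≈ (y ∷ ys)
    swap≈ : ∀ {x y xs} → (x ∷ y ∷ xs) ≈ (y ∷ x ∷ xs)
    trans≈ : ∀ {xs ys zs} → xs ≈ ys → ys ≈ zs → xs ≈ zs

  data _≈ᵢ_ : Item → Item → Set where
    fm≈ : ∀ {A} → fm A ≈ᵢ fm A
    br≈ : ∀ {i Δ Δ′} → Δ ≈ Δ′ → br i Δ ≈ᵢ br i Δ′

-- Unary contexts Γ{ }: the hole sits at some nesting depth, next to other items.
data Ctx : Set where
  hole : Seq → Ctx
  nest : ℕ → Ctx → Seq → Ctx

fill : Ctx → Seq → Seq
fill (hole Δ)     Υ = Υ ++ Δ
fill (nest i Γ Δ) Υ = br i (fill Γ Υ) ∷ Δ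

data Rule : List Seq → Seq → Set where
  r∧ : ∀ Γ A B → Rule (fill Γ (fm A ∷ []) ∷ fill Γ (fm B ∷ []) ∷ [])
                      (fill Γ (fm (A ∧′ B) ∷ []))
  r∨ : ∀ Γ A B → Rule (fill Γ (fm A ∷ fm B ∷ []) ∷ [])
                      (fill Γ (fm (A ∨′ B) ∷ []))
  r□ : ∀ Γ i A → Rule (fill Γ (br i (fm A ∷ fm (◇ i (neg A)) ∷ []) ∷ []) ∷ [])
                      (fill Γ (fm (□ i A) ∷ []))
  r◇ : ∀ Γ i j A Δ → i ≤ j →
       Rule (fill Γ (fm (◇ i A) ∷ br j (fm A ∷ Δ) ∷ []) ∷ [])
            (fill Γ (fm (◇ i A) ∷ br j Δ ∷ []))
  rtran : ∀ Γ i j A Δ → i ≤ j →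
       Rule (fill Γ (fm (◇ i A) ∷ br j (fm (◇ i A) ∷ Δ) ∷ []) ∷ [])
            (fill Γ (fm (◇ i A) ∷ br j Δ ∷ []))
  reucl : ∀ Γ i j A Δ → i < j →
       Rule (fill Γ (fm (◇ i A) ∷ br j (fm (◇ i A) ∷ Δ) ∷ []) ∷ [])
            (fill Γ (br j (fm (◇ i A) ∷ Δ) ∷ []))

-- Provability in GLP_NS + cut(𝒞).  Sequents are multisets, so provability
-- is closed under multiset equality (rule `perm`).
data ⊢[_]_ (𝒞 : List Fm) : Seq → Set where
  ax   : ∀ Γ p → ⊢[ 𝒞 ] fill Γ (fm (at p) ∷ fm (nat p) ∷ [])
  ax⊤  : ∀ Γ → ⊢[ 𝒞 ] fill Γ (fm ⊤′ ∷ [])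
  rule : ∀ {ps c} → Rule ps c → All (⊢[_]_ 𝒞) ps → ⊢[ 𝒞 ] c
  cut  : ∀ Γ A → A ∈ 𝒞 → ⊢[ 𝒞 ] fill Γ (fm A ∷ []) → ⊢[ 𝒞 ] fill Γ (fm (neg A) ∷ [])
         → ⊢[ 𝒞 ] fill Γ []
  perm : ∀ {S S′} → S ≈ S′ → ⊢[ 𝒞 ] S → ⊢[ 𝒞 ] S′

data InvRule : List Seq → Seq → Set where
  glp  : ∀ {ps c} → Rule ps c → InvRule ps c
  r⊥   : ∀ Γ → InvRule (fill Γ [] ∷ []) (fill Γ (fm ⊥′ ∷ []))

module Submission where

-- Every premise of an invertible rule is obtained from its conclusion by
-- a "refinement": items are kept, replaced by one of their inversion
-- images (A ∧ B ↦ A, A ∧ B ↦ B, A ∨ B ↦ A , B, □ᵢA ↦ [A , ◇ᵢ¬A]ᵢ,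
-- ⊥ ↦ ∅), refined inside brackets, and further items may be added
-- (weakening).  The whole theorem therefore follows from one admissibility
-- result: if S is provable and T refines S, then T is provable.
--
-- Admissibility is proved by induction on derivations, rule by
-- rule: a rule whose principal formula is kept is re-applied in the
-- refined context, one whose principal formula is inverted is simply
-- dropped.

open import Defs
open import Data.Nat using (_<_)
open import Data.List using (List; []; _∷_; _++_)
open import Data.List.Properties using (++-assoc; ++-identityʳ)
open import Data.List.Membership.Propositional using (_∈_)
open import Data.List.Relation.Unary.All as All using (All; []; _∷_)
open import Data.Product using (Σ-syntax; _×_; _,_)
open import Relation.Binary.PropositionalEquality using (_≡_; refl; sym; cong; subst)

mutual
  ≈-refl : ∀ xs → xs ≈ xs
  ≈-refl []       = []≈
  ≈-refl (x ∷ xs) = cons≈ (≈ᵢ-refl x) (≈-refl xs)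

  ≈ᵢ-refl : ∀ x → x ≈ᵢ x
  ≈ᵢ-refl (fm A)   = fm≈
  ≈ᵢ-refl (br i Δ) = br≈ (≈-refl Δ)

mutual
  ≈-sym : ∀ {xs ys} → xs ≈ ys → ys ≈ xs
  ≈-sym []≈          = []≈
  ≈-sym (cons≈ p q)  = cons≈ (≈ᵢ-sym p) (≈-sym q)
  ≈-sym swap≈        = swap≈
  ≈-sym (trans≈ p q) = trans≈ (≈-sym q) (≈-sym p)

  ≈ᵢ-sym : ∀ {x y} → x ≈ᵢ y → y ≈ᵢ x
  ≈ᵢ-sym fm≈     = fm≈
  ≈ᵢ-sym (br≈ p) = br≈ (≈-sym p)

≡⇒≈ : ∀ {xs ys} → xs ≡ ys → xs ≈ ys
≡⇒≈ {xs} refl = ≈-refl xs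

++-congˡ : ∀ {xs xs′} ys → xs ≈ xs′ → (xs ++ ys) ≈ (xs′ ++ ys)
++-congˡ ys []≈          = ≈-refl ys
++-congˡ ys (cons≈ p q)  = cons≈ p (++-congˡ ys q)
++-congˡ ys swap≈        = swap≈
++-congˡ ys (trans≈ p q) = trans≈ (++-congˡ ys p) (++-congˡ ys q)

++-congʳ : ∀ xs {ys ys′} → ys ≈ ys′ → (xs ++ ys) ≈ (xs ++ ys′)
++-congʳ []       p = p
++-congʳ (x ∷ xs) p = cons≈ (≈ᵢ-refl x) (++-congʳ xs p)

move-front : ∀ ys x zs → (ys ++ x ∷ zs) ≈ (x ∷ ys ++ zs)
move-front []       x zs = ≈-refl (x ∷ zs)
move-front (y ∷ ys) x zs = trans≈ (cons≈ (≈ᵢ-refl y) (move-front ys x zs)) swap≈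

++-comm≈ : ∀ xs ys → (xs ++ ys) ≈ (ys ++ xs)
++-comm≈ []       ys = ≡⇒≈ (sym (++-identityʳ ys))
++-comm≈ (x ∷ xs) ys =
  trans≈ (cons≈ (≈ᵢ-refl x) (++-comm≈ xs ys)) (≈-sym (move-front ys x xs))

swap-prefix : ∀ xs ys zs → (xs ++ ys ++ zs) ≈ (ys ++ xs ++ zs)
swap-prefix xs ys zs =
  trans≈ (≡⇒≈ (sym (++-assoc xs ys zs)))
  (trans≈ (++-congˡ zs (++-comm≈ xs ys)) (≡⇒≈ (++-assoc ys xs zs)))

fill-cong : ∀ Γ {X Y} → X ≈ Y → fill Γ X ≈ fill Γ Y
fill-cong (hole Δ)     p = ++-congˡ Δ p
fill-cong (nest i Γ Δ) p = cons≈ (br≈ (fill-cong Γ p)) (≈-refl Δ)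

-- Widening a context: Γ⟨W⟩{X} is Γ{X , W}.  Rules are stated for a
-- single formula in the hole, so residual items beside it are moved into
-- the context before a rule is re-applied.
widen : Ctx → Seq → Ctx
widen (hole Δ)     W = hole (W ++ Δ)
widen (nest i Γ Δ) W = nest i (widen Γ W) Δ

fill-widen : ∀ Γ X W → fill (widen Γ W) X ≡ fill Γ (X ++ W)
fill-widen (hole Δ)     X W = sym (++-assoc X W Δ)
fill-widen (nest i Γ Δ) X W = cong (λ s → br i s ∷ Δ) (fill-widen Γ X W)

mutual
  data _↦_ : Item → Seq → Set where
    keep    : ∀ {C} → fm C ↦ (fm C ∷ [])
    inside  : ∀ {i Δ Δ′} → Δ ⊴ Δ′ → br i Δ ↦ (br i Δ′ ∷ [])
    ∧-left  : ∀ {C D} → fm (C ∧′ D) ↦ (fm C ∷ [])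
    ∧-right : ∀ {C D} → fm (C ∧′ D) ↦ (fm D ∷ [])
    ∨-split : ∀ {C D} → fm (C ∨′ D) ↦ (fm C ∷ fm D ∷ [])
    □-open  : ∀ {i C} → fm (□ i C) ↦ (br i (fm C ∷ fm (◇ i (neg C)) ∷ []) ∷ [])
    ⊥-drop  : fm ⊥′ ↦ []

  data _⊴_ : Seq → Seq → Set where
    ⊴[] : ∀ {T} → [] ⊴ T
    ⊴∷  : ∀ {x xs ys T′ T} → x ↦ ys → xs ⊴ T′ → T ≈ (ys ++ T′) → (x ∷ xs) ⊴ T

⊴-refl : ∀ S → S ⊴ S
⊴-refl []            = ⊴[]
⊴-refl (fm C ∷ xs)   = ⊴∷ keep (⊴-refl xs) (≈-refl _)
⊴-refl (br i Δ ∷ xs) = ⊴∷ (inside (⊴-refl Δ)) (⊴-refl xs) (≈-refl _)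

⊴-single : ∀ {x ys} → x ↦ ys → (x ∷ []) ⊴ ys
⊴-single {ys = ys} m = ⊴∷ m ⊴[] (≡⇒≈ (sym (++-identityʳ ys)))

⊴-weaken : ∀ W {S T} → S ⊴ T → S ⊴ (W ++ T)
⊴-weaken W ⊴[] = ⊴[]
⊴-weaken W (⊴∷ {ys = ys} {T′} m q e) =
  ⊴∷ m (⊴-weaken W q) (trans≈ (++-congʳ W e) (swap-prefix W ys T′))

⊴-++ : ∀ {U U′ V V′} → U ⊴ U′ → V ⊴ V′ → (U ++ V) ⊴ (U′ ++ V′)
⊴-++ {U′ = U′} ⊴[] h = ⊴-weaken U′ h
⊴-++ {V′ = V′} (⊴∷ {ys = ys} {T′} m q e) h =
  ⊴∷ m (⊴-++ q h) (trans≈ (++-congˡ V′ e) (≡⇒≈ (++-assoc ys T′ V′)))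

⊴-respʳ : ∀ {S T T′} → S ⊴ T → T′ ≈ T → S ⊴ T′
⊴-respʳ ⊴[]          e = ⊴[]
⊴-respʳ (⊴∷ m q e′) e = ⊴∷ m q (trans≈ e e′)

⊴-extend : ∀ W {S T} → S ⊴ T → S ⊴ (T ++ W)
⊴-extend W {T = T} h = ⊴-respʳ (⊴-weaken W h) (++-comm≈ T W)

⊴-fill : ∀ Γ {V V′} → V ⊴ V′ → fill Γ V ⊴ fill Γ V′
⊴-fill (hole Δ)     h = ⊴-++ h (⊴-refl Δ)
⊴-fill (nest i Γ Δ) h = ⊴∷ (inside (⊴-fill Γ h)) (⊴-refl Δ) (≈-refl _)

⊴-bracket : ∀ {C j Δ Δ′} → Δ ⊴ Δ′ → (fm C ∷ br j Δ ∷ []) ⊴ (fm C ∷ br j Δ′ ∷ [])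
⊴-bracket q = ⊴∷ keep (⊴-single (inside q)) (≈-refl _)

⊴-bracket-tail : ∀ {C j B Δ Δ′} → Δ ⊴ Δ′ →
                 (fm C ∷ br j (fm B ∷ Δ) ∷ []) ⊴ (fm C ∷ br j (fm B ∷ Δ′) ∷ [])
⊴-bracket-tail q = ⊴-bracket (⊴∷ keep q (≈-refl _))

add-to-bracket : ∀ {C j Δ} x → (fm C ∷ br j Δ ∷ []) ⊴ (fm C ∷ br j (x ∷ Δ) ∷ [])
add-to-bracket {Δ = Δ} x = ⊴-bracket (⊴-weaken (x ∷ []) (⊴-refl Δ))

mutual
  ⊴-respˡ : ∀ {S₀ S T} → S₀ ≈ S → S ⊴ T → S₀ ⊴ T
  ⊴-respˡ []≈         h             = h
  ⊴-respˡ (cons≈ p q) (⊴∷ m r e)    = ⊴∷ (↦-respˡ p m) (⊴-respˡ q r) e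
  ⊴-respˡ swap≈ (⊴∷ {ys = ys₁} m₁ (⊴∷ {ys = ys₂} {T₂} m₂ r e₂) e₁) =
    ⊴∷ m₂ (⊴∷ m₁ r (≈-refl _))
      (trans≈ e₁ (trans≈ (++-congʳ ys₁ e₂) (swap-prefix ys₁ ys₂ T₂)))
  ⊴-respˡ (trans≈ p q) h            = ⊴-respˡ p (⊴-respˡ q h)

  ↦-respˡ : ∀ {x y ys} → x ≈ᵢ y → y ↦ ys → x ↦ ys
  ↦-respˡ fm≈     m          = m
  ↦-respˡ (br≈ p) (inside h) = inside (⊴-respˡ p h)

⊴-split : ∀ U {Δ T} → (U ++ Δ) ⊴ T →
          Σ[ U′ ∈ Seq ] Σ[ Δ′ ∈ Seq ] (T ≈ (U′ ++ Δ′)) × (U ⊴ U′) × (Δ ⊴ Δ′)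
⊴-split []      {T = T} h = [] , T , ≈-refl T , ⊴[] , h
⊴-split (x ∷ U) (⊴∷ {ys = ys} m q e) with ⊴-split U q
... | U′ , Δ′ , e′ , u , d =
  ys ++ U′ , Δ′ , trans≈ e (trans≈ (++-congʳ ys e′) (≡⇒≈ (sym (++-assoc ys U′ Δ′)))) ,
  ⊴∷ m u (≈-refl _) , d

record Decomposition (Γ : Ctx) (U T : Seq) : Set where
  constructor decomposition
  field
    context  : Ctx
    hole-seq : Seq
    shape    : T ≈ fill context hole-seq
    refines  : U ⊴ hole-seq
    transfer : ∀ {V V′} → V ⊴ V′ → fill Γ V ⊴ fill context V′

decompose : ∀ Γ {U T} → fill Γ U ⊴ T → Decomposition Γ U T
decompose (hole Δ) {U} h with ⊴-split U h
... | U′ , Δ′ , e , u , d = decomposition (hole Δ′) U′ e u (λ v → ⊴-++ v d)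
decompose (nest i Γ Δ) (⊴∷ (inside q₀) q e) with decompose Γ q₀
... | decomposition Γ′ U′ e′ u tr =
  decomposition (nest i Γ′ _) U′ (trans≈ e (cons≈ (br≈ e′) (≈-refl _))) u
    (λ v → ⊴∷ (inside (tr v)) q (≈-refl _))

module _ {𝒞 : List Fm} where

  Admits : Seq → Set
  Admits S = ∀ {T} → S ⊴ T → ⊢[ 𝒞 ] T

  ⊢-widen : ∀ Γ X W → ⊢[ 𝒞 ] fill (widen Γ W) X → ⊢[ 𝒞 ] fill Γ (X ++ W)
  ⊢-widen Γ X W = subst (⊢[_]_ 𝒞) (fill-widen Γ X W)

  ⊢-unwiden : ∀ Γ X W → ⊢[ 𝒞 ] fill Γ (X ++ W) → ⊢[ 𝒞 ] fill (widen Γ W) X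
  ⊢-unwiden Γ X W = subst (⊢[_]_ 𝒞) (sym (fill-widen Γ X W))

  close : ∀ {T} Γ′ {U′ X} → T ≈ fill Γ′ U′ → U′ ≈ X → ⊢[ 𝒞 ] fill Γ′ X → ⊢[ 𝒞 ] T
  close Γ′ e₁ e₂ d = perm (≈-sym e₁) (perm (fill-cong Γ′ (≈-sym e₂)) d)

  -- A premise Γ{V} of a rule whose principal items are kept: refining V
  -- to V′ along the decomposition yields a premise of the same rule in
  -- the widened context Γ′⟨W⟩.
  reenter : ∀ Γ Γ′ W {V V′} → Admits (fill Γ V) →
            (∀ {V V′} → V ⊴ V′ → fill Γ V ⊴ fill Γ′ V′) →
            V ⊴ V′ → ⊢[ 𝒞 ] fill (widen Γ′ W) V′
  reenter Γ Γ′ W {V′ = V′} ih tr v = ⊢-unwiden Γ′ V′ W (ih (tr (⊴-extend W v)))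

  -- A premise Γ{V} whose hole content V is the image of an inverted
  -- principal formula: its refinement along the decomposition is the goal.
  inverted : ∀ Γ Γ′ {V W} → Admits (fill Γ V) →
             (∀ {V V′} → V ⊴ V′ → fill Γ V ⊴ fill Γ′ V′) → ⊢[ 𝒞 ] fill Γ′ (V ++ W)
  inverted Γ Γ′ ih tr = ih (tr (⊴-extend _ (⊴-refl _)))

  -- Initial sequents: their principal formulas can only be kept.
  axiom-admits : ∀ Γ p → Admits (fill Γ (fm (at p) ∷ fm (nat p) ∷ []))
  axiom-admits Γ p h with decompose Γ h
  ... | decomposition Γ′ _ e (⊴∷ keep (⊴∷ {T′ = W} keep _ e₂) e₁) _ =
    close Γ′ e (trans≈ e₁ (cons≈ fm≈ e₂)) (⊢-widen Γ′ _ W (ax (widen Γ′ W) p))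

  ⊤-admits : ∀ Γ → Admits (fill Γ (fm ⊤′ ∷ []))
  ⊤-admits Γ h with decompose Γ h
  ... | decomposition Γ′ _ e (⊴∷ {T′ = W} keep _ e₁) _ =
    close Γ′ e e₁ (⊢-widen Γ′ _ W (ax⊤ (widen Γ′ W)))

  -- Cut has an empty hole; it is re-applied in the refined context.
  cut-admits : ∀ Γ A → A ∈ 𝒞 → Admits (fill Γ (fm A ∷ [])) →
               Admits (fill Γ (fm (neg A) ∷ [])) → Admits (fill Γ [])
  cut-admits Γ A A∈𝒞 ih₁ ih₂ h with decompose Γ h
  ... | decomposition Γ′ U′ e _ tr =
    close Γ′ e (≈-refl U′) (⊢-widen Γ′ [] U′
      (cut (widen Γ′ U′) A A∈𝒞 (reenter Γ Γ′ U′ ih₁ tr (⊴-refl _))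
                               (reenter Γ Γ′ U′ ih₂ tr (⊴-refl _))))

  -- ∧, ∨, □: if the principal formula is kept the rule is re-applied,
  -- otherwise it was inverted and a refined premise is the goal itself.
  ∧-admits : ∀ Γ C D → Admits (fill Γ (fm C ∷ [])) → Admits (fill Γ (fm D ∷ [])) →
             Admits (fill Γ (fm (C ∧′ D) ∷ []))
  ∧-admits Γ C D ih₁ ih₂ h with decompose Γ h
  ... | decomposition Γ′ _ e (⊴∷ {T′ = W} keep _ e₁) tr =
    close Γ′ e e₁ (⊢-widen Γ′ _ W (rule (r∧ (widen Γ′ W) C D)
      (reenter Γ Γ′ W ih₁ tr (⊴-refl _) ∷ reenter Γ Γ′ W ih₂ tr (⊴-refl _) ∷ [])))
  ... | decomposition Γ′ _ e (⊴∷ ∧-left _ e₁) tr = close Γ′ e e₁ (inverted Γ Γ′ ih₁ tr)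
  ... | decomposition Γ′ _ e (⊴∷ ∧-right _ e₁) tr = close Γ′ e e₁ (inverted Γ Γ′ ih₂ tr)

  ∨-admits : ∀ Γ C D → Admits (fill Γ (fm C ∷ fm D ∷ [])) →
             Admits (fill Γ (fm (C ∨′ D) ∷ []))
  ∨-admits Γ C D ih h with decompose Γ h
  ... | decomposition Γ′ _ e (⊴∷ {T′ = W} keep _ e₁) tr =
    close Γ′ e e₁ (⊢-widen Γ′ _ W (rule (r∨ (widen Γ′ W) C D)
      (reenter Γ Γ′ W ih tr (⊴-refl _) ∷ [])))
  ... | decomposition Γ′ _ e (⊴∷ ∨-split _ e₁) tr = close Γ′ e e₁ (inverted Γ Γ′ ih tr)

  □-admits : ∀ Γ i C → Admits (fill Γ (br i (fm C ∷ fm (◇ i (neg C)) ∷ []) ∷ [])) →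
             Admits (fill Γ (fm (□ i C) ∷ []))
  □-admits Γ i C ih h with decompose Γ h
  ... | decomposition Γ′ _ e (⊴∷ {T′ = W} keep _ e₁) tr =
    close Γ′ e e₁ (⊢-widen Γ′ _ W (rule (r□ (widen Γ′ W) i C)
      (reenter Γ Γ′ W ih tr (⊴-refl _) ∷ [])))
  ... | decomposition Γ′ _ e (⊴∷ □-open _ e₁) tr = close Γ′ e e₁ (inverted Γ Γ′ ih tr)

  -- The rules ◇ and tran both add a formula B to a bracket [Δ]ⱼ lying
  -- next to the principal formula ◇ᵢA, which is kept.
  bracket-admits : ∀ Γ i j A B {Δ} →
    (∀ Γ Δ → Rule (fill Γ (fm (◇ i A) ∷ br j (fm B ∷ Δ) ∷ []) ∷ [])
                  (fill Γ (fm (◇ i A) ∷ br j Δ ∷ []))) →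
    Admits (fill Γ (fm (◇ i A) ∷ br j (fm B ∷ Δ) ∷ [])) →
    Admits (fill Γ (fm (◇ i A) ∷ br j Δ ∷ []))
  bracket-admits Γ i j A B r ih h with decompose Γ h
  ... | decomposition Γ′ _ e (⊴∷ keep (⊴∷ {T′ = W} (inside {Δ′ = Δ′} q) _ e₂) e₁) tr =
    close Γ′ e (trans≈ e₁ (cons≈ fm≈ e₂)) (⊢-widen Γ′ _ W (rule (r (widen Γ′ W) Δ′)
      (reenter Γ Γ′ W ih tr (⊴-bracket-tail q) ∷ [])))

  -- eucl: the principal formula sits inside the bracket, and is kept.
  eucl-admits : ∀ Γ i j A Δ → i < j →
    Admits (fill Γ (fm (◇ i A) ∷ br j (fm (◇ i A) ∷ Δ) ∷ [])) →
    Admits (fill Γ (br j (fm (◇ i A) ∷ Δ) ∷ []))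
  eucl-admits Γ i j A Δ i<j ih h with decompose Γ h
  ... | decomposition Γ′ _ e (⊴∷ {T′ = W} (inside (⊴∷ {T′ = Δ′} keep q e₃)) _ e₁) tr =
    close Γ′ e (trans≈ e₁ (cons≈ (br≈ e₃) (≈-refl _))) (⊢-widen Γ′ _ W
      (rule (reucl (widen Γ′ W) i j A Δ′ i<j)
        (reenter Γ Γ′ W ih tr (⊴-bracket-tail q) ∷ [])))

  rule-admits : ∀ {ps c} → Rule ps c → All Admits ps → Admits c
  rule-admits (r∧ Γ C D)              (ih₁ ∷ ih₂ ∷ []) = ∧-admits Γ C D ih₁ ih₂
  rule-admits (r∨ Γ C D)              (ih ∷ [])        = ∨-admits Γ C D ih
  rule-admits (r□ Γ i C)              (ih ∷ [])        = □-admits Γ i C ih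
  rule-admits (r◇ Γ i j A Δ i≤j)      (ih ∷ [])        =
    bracket-admits Γ i j A A (λ Γ Δ → r◇ Γ i j A Δ i≤j) ih
  rule-admits (rtran Γ i j A Δ i≤j)   (ih ∷ [])        =
    bracket-admits Γ i j A (◇ i A) (λ Γ Δ → rtran Γ i j A Δ i≤j) ih
  rule-admits (reucl Γ i j A Δ i<j)   (ih ∷ [])        = eucl-admits Γ i j A Δ i<j ih

  mutual
    admissible : ∀ {S} → ⊢[ 𝒞 ] S → Admits S
    admissible (ax Γ p)              = axiom-admits Γ p
    admissible (ax⊤ Γ)               = ⊤-admits Γ
    admissible (rule r ds)           = rule-admits r (admissible* ds)
    admissible (cut Γ A A∈𝒞 d₁ d₂)   = cut-admits Γ A A∈𝒞 (admissible d₁) (admissible d₂)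
    admissible (perm p d) h          = admissible d (⊴-respˡ p h)

    admissible* : ∀ {ps} → All (⊢[_]_ 𝒞) ps → All Admits ps
    admissible* []       = []
    admissible* (d ∷ ds) = admissible d ∷ admissible* ds

premises-refine : ∀ {ps c} → InvRule ps c → All (c ⊴_) ps
premises-refine (glp (r∧ Γ A B)) =
  ⊴-fill Γ (⊴-single ∧-left) ∷ ⊴-fill Γ (⊴-single ∧-right) ∷ []
premises-refine (glp (r∨ Γ A B)) = ⊴-fill Γ (⊴-single ∨-split) ∷ []
premises-refine (glp (r□ Γ i A)) = ⊴-fill Γ (⊴-single □-open) ∷ []
premises-refine (glp (r◇ Γ i j A Δ _))    = ⊴-fill Γ (add-to-bracket (fm A)) ∷ []
premises-refine (glp (rtran Γ i j A Δ _)) = ⊴-fill Γ (add-to-bracket (fm (◇ i A))) ∷ []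
premises-refine (glp (reucl Γ i j A Δ _)) =    -- weakening by ◇ᵢA
  ⊴-fill Γ (⊴∷ (inside (⊴-refl _)) ⊴[] swap≈) ∷ []
premises-refine (r⊥ Γ) = ⊴-fill Γ (⊴∷ ⊥-drop ⊴[] []≈) ∷ []

lemma5 : (𝒞 : List Fm) → Adequate 𝒞 →
         ∀ {ps : List Seq} {c : Seq} → InvRule ps c → ⊢[ 𝒞 ] c → All (⊢[_]_ 𝒞) ps
lemma5 𝒞 _ r d = All.map (admissible d) (premises-refine r)
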